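{- Let $(S_1,S_2)$ be an Euler pair such that every element of $S_2$ is odd. Then for every $n\geqslant 0$, $$(-1)^n q(S_2;n)=p_e(S_1;n)-p_o(S_1;n).$$
   Context: For a set $S$ of positive integers, $p(S;n)$ is the number of partitions of $n$ with all parts in $S$, and $q(S;n)$ is the number of partitions of $n$ into distinct parts, all in $S$. $p_e(S;n)$ (resp. $p_o(S;n)$) is the number of partitions of $n$ with parts in $S$ having an even (resp. odd) number of parts. A pair $(S_1,S_2)$ of subsets of the positive integers is an Euler pair if $q(S_1;n)=p(S_2;n)$ for all $n\geqslant 0$. -}

module Defs where

open import Data.Bool using (Bool; true; false; _∧_; not)
open import Data.Nat using (ℕ; zero; suc; _∸_; _⊓_; _<ᵇ_; _≡ᵇ_; _%_)
open import Relation.Binary.PropositionalEquality using (_≡_)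
open import Data.List using (List; []; _∷_; [_]; map; concatMap; applyUpTo; filterᵇ; length)

-- A set S of positive integers is represented by its (decidable) characteristic
-- function S : ℕ → Bool; the value at 0 is irrelevant since parts are positive.

-- partitionsLE fuel m n : all partitions of n (as non-increasing lists of
-- positive integers) whose parts are all ≤ m.  The fuel only guarantees
-- termination; fuel ≥ n suffices since every step removes a positive part.
partitionsLE : ℕ → ℕ → ℕ → List (List ℕ)
partitionsLE _        _ zero    = [ [] ]
partitionsLE zero     _ (suc n) = []
partitionsLE (suc f)  m (suc n) =
  concatMap (λ k → map (k ∷_) (partitionsLE f k (suc n ∸ k)))
            (applyUpTo suc (m ⊓ suc n))

partitions : ℕ → List (List ℕ)
partitions n = partitionsLE n n n

partsIn : (ℕ → Bool) → List ℕ → Bool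
partsIn S []       = true
partsIn S (x ∷ xs) = S x ∧ partsIn S xs

-- parts pairwise distinct (for a non-increasing list: strictly decreasing)
strictlyDecreasing : List ℕ → Bool
strictlyDecreasing []           = true
strictlyDecreasing (x ∷ [])     = true
strictlyDecreasing (x ∷ y ∷ xs) = (y <ᵇ x) ∧ strictlyDecreasing (y ∷ xs)

isEven : ℕ → Bool
isEven n = n % 2 ≡ᵇ 0

p : (ℕ → Bool) → ℕ → ℕ
p S n = length (filterᵇ (partsIn S) (partitions n))

q : (ℕ → Bool) → ℕ → ℕ
q S n = length (filterᵇ (λ λ' → partsIn S λ' ∧ strictlyDecreasing λ') (partitions n))

pₑ : (ℕ → Bool) → ℕ → ℕ
pₑ S n = length (filterᵇ (λ λ' → partsIn S λ' ∧ isEven (length λ')) (partitions n))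

pₒ : (ℕ → Bool) → ℕ → ℕ
pₒ S n = length (filterᵇ (λ λ' → partsIn S λ' ∧ not (isEven (length λ'))) (partitions n))

EulerPair : (ℕ → Bool) → (ℕ → Bool) → Set
EulerPair S₁ S₂ = ∀ (n : ℕ) → q S₁ n ≡ p S₂ n

-- In generating functions, the Euler pair says that
--   Q(x) := ∏_{k ∈ S₁} (1 + xᵏ) = ∏_{k ∈ S₂} (1 − xᵏ)⁻¹ .
-- Hence ∑ₙ (pₑ − pₒ)(S₁; n) xⁿ = ∏_{k ∈ S₁} (1 + xᵏ)⁻¹ = Q(x)⁻¹ = ∏_{k ∈ S₂} (1 − xᵏ),
-- and as every k ∈ S₂ is odd, ∏_{k ∈ S₂} (1 − xᵏ) = ∏_{k ∈ S₂} (1 + (−x)ᵏ) = ∑ₙ q(S₂; n) (−x)ⁿ.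
-- Power series are coefficient functions ℕ → ℤ; an infinite product is read off from its
-- truncations ∏_{k ≤ m}, whose coefficient of xᴺ no longer changes once m ≥ N, and Q(x)⁻¹ is
-- unique because Q has constant term 1.
module Submission where

open import Defs
open import Data.Bool using (Bool; true; false; if_then_else_; _∧_; not)
open import Data.Bool.Properties using (∧-comm)
open import Data.Nat using (ℕ; zero; suc; _∸_; _⊓_; _<ᵇ_; _≡ᵇ_; _≤_; _<_; z≤n; z<s; s≤s; s≤s⁻¹; _%_; _≤?_)
import Data.Nat.Properties as ℕ
open import Data.Nat.Induction using (<-rec)
open import Algebra.Properties.CommutativeSemigroup ℕ.⊓-commutativeSemigroup using (xy∙z≈xz∙y)
open import Data.Integer using (ℤ; +_; -1ℤ; 0ℤ; 1ℤ; _^_; _*_; _-_; _+_; -_)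
open import Data.Integer.Properties
  using (*-identityˡ; *-zeroʳ; +-identityˡ; +-identityʳ; ^-zeroˡ; ^-distribˡ-+-*)
open import Data.Integer.Tactic.RingSolver using (solve-∀)
open import Data.List using (List; []; _∷_; map; concatMap; applyUpTo; filterᵇ; length; _++_)
open import Function using (id; _∘_)
open import Relation.Binary.PropositionalEquality
  using (_≡_; refl; sym; trans; cong; cong₂; _≗_; module ≡-Reasoning)
open import Relation.Nullary using (yes; no)

open ≡-Reasoning

∑< : ℕ → (ℕ → ℤ) → ℤ
∑< zero    h = 0ℤ
∑< (suc n) h = h 0 + ∑< n (h ∘ suc)

syntax ∑< n (λ i → e) = ∑[ i < n ] e

∑-cong< : ∀ n {g h : ℕ → ℤ} → (∀ i → i < n → g i ≡ h i) → ∑< n g ≡ ∑< n h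
∑-cong< zero    eq = refl
∑-cong< (suc n) eq = cong₂ _+_ (eq 0 (s≤s z≤n)) (∑-cong< n (λ i i<n → eq (suc i) (s≤s i<n)))

∑-cong : ∀ n {g h : ℕ → ℤ} → g ≗ h → ∑< n g ≡ ∑< n h
∑-cong n eq = ∑-cong< n (λ i _ → eq i)

∑-zero : ∀ n → ∑[ i < n ] 0ℤ ≡ 0ℤ
∑-zero zero    = refl
∑-zero (suc n) = trans (+-identityˡ _) (∑-zero n)

∑-snoc : ∀ n h → ∑< (suc n) h ≡ ∑< n h + h n
∑-snoc zero    h = trans (+-identityʳ (h 0)) (sym (+-identityˡ (h 0)))
∑-snoc (suc n) h = trans (cong (_+_ (h 0)) (∑-snoc n (h ∘ suc))) (+-assoc (h 0) _ _)
  where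
  +-assoc : ∀ a b c → a + (b + c) ≡ (a + b) + c
  +-assoc = solve-∀

∑-+ : ∀ n g h → ∑[ i < n ] (g i + h i) ≡ ∑< n g + ∑< n h
∑-+ zero    g h = refl
∑-+ (suc n) g h =
  trans (cong (_+_ (g 0 + h 0)) (∑-+ n (g ∘ suc) (h ∘ suc))) (+-interchange (g 0) (h 0) _ _)
  where
  +-interchange : ∀ a b c d → (a + b) + (c + d) ≡ (a + c) + (b + d)
  +-interchange = solve-∀

∑-*ˡ : ∀ n a h → ∑[ i < n ] (a * h i) ≡ a * ∑< n h
∑-*ˡ zero    a h = sym (*-zeroʳ a)
∑-*ˡ (suc n) a h = trans (cong (_+_ (a * h 0)) (∑-*ˡ n a (h ∘ suc))) (distribˡ a (h 0) _)
  where
  distribˡ : ∀ a b c → a * b + a * c ≡ a * (b + c)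
  distribˡ = solve-∀

⟦_⟧ : Bool → ℤ
⟦ b ⟧ = if b then 1ℤ else 0ℤ

∑-⊓ : ∀ n b h → ∑[ i < n ] (⟦ i <ᵇ b ⟧ * h i) ≡ ∑< (n ⊓ b) h
∑-⊓ zero    b       h = refl
∑-⊓ (suc n) zero    h = ∑-zero (suc n)
∑-⊓ (suc n) (suc b) h = cong₂ _+_ (*-identityˡ (h 0)) (∑-⊓ n b (h ∘ suc))

Series : Set
Series = ℕ → ℤ

𝟏 : Series
𝟏 zero    = 1ℤ
𝟏 (suc _) = 0ℤ

shift : ℕ → Series → Series
shift zero    f N       = f N
shift (suc k) f zero    = 0ℤ
shift (suc k) f (suc N) = shift k f N

addShifted : ℤ → ℕ → Series → Series
addShifted a k f N = f N + a * shift k f N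

shift-≤ : ∀ k f {N} → k ≤ N → shift k f N ≡ f (N ∸ k)
shift-≤ zero    f _         = refl
shift-≤ (suc k) f (s≤s k≤N) = shift-≤ k f k≤N

shift-< : ∀ k f {N} → N < k → shift k f N ≡ 0ℤ
shift-< (suc k) f {zero}  _         = refl
shift-< (suc k) f {suc N} (s≤s N<k) = shift-< k f N<k

infixl 7 _⊛_

-- Opaque, so that unification sees f ⊛ g rather than the unfolded sum.
opaque
  _⊛_ : Series → Series → Series
  (f ⊛ g) N = ∑[ j < suc N ] (f j * g (N ∸ j))

  ⊛-local : ∀ {f f′ g g′} N → (∀ j → j ≤ N → f j ≡ f′ j) → (∀ j → j ≤ N → g j ≡ g′ j) →
            (f ⊛ g) N ≡ (f′ ⊛ g′) N
  ⊛-local N eqf eqg = ∑-cong< (suc N) λ { j (s≤s j≤N) → cong₂ _*_ (eqf j j≤N) (eqg (N ∸ j) (ℕ.m∸n≤m N j)) }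

  ⊛-cong : ∀ {f f′ g g′} → f ≗ f′ → g ≗ g′ → f ⊛ g ≗ f′ ⊛ g′
  ⊛-cong eqf eqg N = ⊛-local N (λ j _ → eqf j) (λ j _ → eqg j)

  ⊛-identityˡ : ∀ f → 𝟏 ⊛ f ≗ f
  ⊛-identityˡ f N = trans (cong₂ _+_ (*-identityˡ (f N)) (∑-zero N)) (+-identityʳ (f N))

  shift-⊛ : ∀ k f g → shift k f ⊛ g ≗ shift k (f ⊛ g)
  shift-⊛ zero    f g N       = refl
  shift-⊛ (suc k) f g zero    = refl
  shift-⊛ (suc k) f g (suc N) = trans (+-identityˡ _) (shift-⊛ k f g N)

  ⊛-shift : ∀ k f g → f ⊛ shift k g ≗ shift k (f ⊛ g)
  ⊛-shift zero    f g N       = refl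
  ⊛-shift (suc k) f g zero    = trans (+-identityʳ _) (*-zeroʳ (f 0))
  ⊛-shift (suc k) f g (suc N) = begin
    ∑[ j < suc (suc N) ] (f j * shift (suc k) g (suc N ∸ j))
      ≡⟨ ∑-snoc (suc N) (λ j → f j * shift (suc k) g (suc N ∸ j)) ⟩
    ∑[ j < suc N ] (f j * shift (suc k) g (suc N ∸ j)) + f (suc N) * shift (suc k) g (suc N ∸ suc N)
      ≡⟨ cong₂ _+_ (∑-cong< (suc N) λ { j (s≤s j≤N) → cong (λ r → f j * shift (suc k) g r) (ℕ.+-∸-assoc 1 j≤N) })
                   (trans (cong (λ r → f (suc N) * shift (suc k) g r) (ℕ.n∸n≡0 N)) (*-zeroʳ (f (suc N)))) ⟩
    (f ⊛ shift k g) N + 0ℤ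
      ≡⟨ +-identityʳ _ ⟩
    (f ⊛ shift k g) N
      ≡⟨ ⊛-shift k f g N ⟩
    shift k (f ⊛ g) N ∎

  addShifted-⊛ : ∀ a k f g → addShifted a k f ⊛ g ≗ addShifted a k (f ⊛ g)
  addShifted-⊛ a k f g N = begin
    ∑[ j < suc N ] ((f j + a * shift k f j) * g (N ∸ j))
      ≡⟨ ∑-cong (suc N) (λ j → distribʳ (f j) a (shift k f j) (g (N ∸ j))) ⟩
    ∑[ j < suc N ] (f j * g (N ∸ j) + a * (shift k f j * g (N ∸ j)))
      ≡⟨ ∑-+ (suc N) (λ j → f j * g (N ∸ j)) (λ j → a * (shift k f j * g (N ∸ j))) ⟩
    (f ⊛ g) N + ∑[ j < suc N ] (a * (shift k f j * g (N ∸ j)))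
      ≡⟨ cong (_+_ ((f ⊛ g) N)) (trans (∑-*ˡ (suc N) a (λ j → shift k f j * g (N ∸ j))) (cong (a *_) (shift-⊛ k f g N))) ⟩
    addShifted a k (f ⊛ g) N ∎
    where
    distribʳ : ∀ x a y z → (x + a * y) * z ≡ x * z + a * (y * z)
    distribʳ = solve-∀

  ⊛-addShifted : ∀ a k f g → f ⊛ addShifted a k g ≗ addShifted a k (f ⊛ g)
  ⊛-addShifted a k f g N = begin
    ∑[ j < suc N ] (f j * (g (N ∸ j) + a * shift k g (N ∸ j)))
      ≡⟨ ∑-cong (suc N) (λ j → distribˡ (f j) a (g (N ∸ j)) (shift k g (N ∸ j))) ⟩
    ∑[ j < suc N ] (f j * g (N ∸ j) + a * (f j * shift k g (N ∸ j)))
      ≡⟨ ∑-+ (suc N) (λ j → f j * g (N ∸ j)) (λ j → a * (f j * shift k g (N ∸ j))) ⟩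
    (f ⊛ g) N + ∑[ j < suc N ] (a * (f j * shift k g (N ∸ j)))
      ≡⟨ cong (_+_ ((f ⊛ g) N)) (trans (∑-*ˡ (suc N) a (λ j → f j * shift k g (N ∸ j))) (cong (a *_) (⊛-shift k f g N))) ⟩
    addShifted a k (f ⊛ g) N ∎
    where
    distribˡ : ∀ x a y z → x * (y + a * z) ≡ x * y + a * (x * z)
    distribˡ = solve-∀

  addShifted-⊛-transfer : ∀ a k f g → addShifted a k f ⊛ g ≗ f ⊛ addShifted a k g
  addShifted-⊛-transfer a k f g N = trans (addShifted-⊛ a k f g N) (sym (⊛-addShifted a k f g N))

  ⊛-cancelˡ : ∀ {u x y} → u 0 ≡ 1ℤ → u ⊛ x ≗ u ⊛ y → x ≗ y
  ⊛-cancelˡ {u} {x} {y} u₀≡1 eq = <-rec (λ N → x N ≡ y N) step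
    where
    tail : Series → ℕ → ℤ
    tail z N = ∑[ j < N ] (u (suc j) * z (N ∸ suc j))

    cancel : ∀ a b t → 1ℤ * a + t ≡ 1ℤ * b + t → a ≡ b
    cancel a b t eq′ = trans (lemma a t) (trans (cong (_- t) eq′) (sym (lemma b t)))
      where
      lemma : ∀ a t → a ≡ (1ℤ * a + t) - t
      lemma = solve-∀

    step : ∀ N → (∀ {M} → M < N → x M ≡ y M) → x N ≡ y N
    step N ih = cancel (x N) (y N) (tail x N) (begin
      1ℤ * x N + tail x N   ≡⟨ cong (λ a → a * x N + tail x N) (sym u₀≡1) ⟩
      (u ⊛ x) N             ≡⟨ eq N ⟩
      u 0 * y N + tail y N  ≡⟨ cong₂ (λ a t → a * y N + t) u₀≡1 (∑-cong< N earlier) ⟩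
      1ℤ * y N + tail x N   ∎)
      where
      earlier : ∀ j → j < N → u (suc j) * y (N ∸ suc j) ≡ u (suc j) * x (N ∸ suc j)
      earlier j j<N = cong (u (suc j) *_) (sym (ih (ℕ.∸-monoʳ-< {o = 0} z<s j<N)))

-- partitionSum next c fuel m N sums ∏ᵢ c(λᵢ) over the partitions λ of N with parts ≤ m in which a
-- part i+1 may only be followed by parts ≤ next i; the fuel is that of partitionsLE.
partitionSum : (ℕ → ℕ) → (ℕ → ℤ) → ℕ → ℕ → ℕ → ℤ
partitionSum next c fuel     m zero    = 1ℤ
partitionSum next c zero     m (suc n) = 0ℤ
partitionSum next c (suc fuel) m (suc n) =
  ∑[ i < m ⊓ suc n ] (c (suc i) * partitionSum next c fuel (next i) (n ∸ i))

module _ (next : ℕ → ℕ) (c : ℕ → ℤ) where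

  partitionSum-fuel : ∀ f g m N → N ≤ f → N ≤ g → partitionSum next c f m N ≡ partitionSum next c g m N
  partitionSum-fuel f       g       m zero    _         _         = refl
  partitionSum-fuel (suc f) (suc g) m (suc n) (s≤s n≤f) (s≤s n≤g) =
    ∑-cong (m ⊓ suc n) λ i → cong (c (suc i) *_)
      (partitionSum-fuel f g (next i) (n ∸ i) (ℕ.≤-trans (ℕ.m∸n≤m n i) n≤f) (ℕ.≤-trans (ℕ.m∸n≤m n i) n≤g))

  series : ℕ → Series
  series m N = partitionSum next c N m N

  series-zero : series 0 ≗ 𝟏
  series-zero zero    = refl
  series-zero (suc n) = refl

  series-suc : ∀ m N → series (suc m) N ≡ series m N + c (suc m) * shift (suc m) (series (next m)) N
  series-suc m zero    = sym (cong (_+_ 1ℤ) (*-zeroʳ (c (suc m))))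
  series-suc m (suc n) with m ≤? n
  ... | yes m≤n = begin
    ∑< (suc (m ⊓ n)) term           ≡⟨ cong (λ r → ∑< (suc r) term) (ℕ.m≤n⇒m⊓n≡m m≤n) ⟩
    ∑< (suc m) term                 ≡⟨ ∑-snoc m term ⟩
    ∑< m term + term m              ≡⟨ cong₂ _+_ (cong (λ r → ∑< r term) (sym (ℕ.m≤n⇒m⊓n≡m (ℕ.m≤n⇒m≤1+n m≤n))))
                                                  (cong (c (suc m) *_) lastFactor) ⟩
    ∑< (m ⊓ suc n) term + c (suc m) * shift m (series (next m)) n ∎
    where
    term : ℕ → ℤ
    term i = c (suc i) * partitionSum next c n (next i) (n ∸ i)
    lastFactor : partitionSum next c n (next m) (n ∸ m) ≡ shift m (series (next m)) n
    lastFactor = trans (partitionSum-fuel n (n ∸ m) (next m) (n ∸ m) (ℕ.m∸n≤m n m) ℕ.≤-refl)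
                       (sym (shift-≤ m (series (next m)) m≤n))
  ... | no m≰n = begin
    ∑< (suc (m ⊓ n)) term           ≡⟨ cong (λ r → ∑< r term) (trans (cong suc (ℕ.m≥n⇒m⊓n≡n (ℕ.<⇒≤ n<m)))
                                                                     (sym (ℕ.m≥n⇒m⊓n≡n n<m))) ⟩
    ∑< (m ⊓ suc n) term             ≡⟨ sym (+-identityʳ _) ⟩
    ∑< (m ⊓ suc n) term + 0ℤ        ≡⟨ cong (λ z → ∑< (m ⊓ suc n) term + z)
                                            (sym (trans (cong (c (suc m) *_) (shift-< m (series (next m)) n<m))
                                                        (*-zeroʳ (c (suc m))))) ⟩
    ∑< (m ⊓ suc n) term + c (suc m) * shift m (series (next m)) n ∎
    where
    n<m : n < m
    n<m = ℕ.≰⇒> m≰n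
    term : ℕ → ℤ
    term i = c (suc i) * partitionSum next c n (next i) (n ∸ i)

  series-stable : ∀ {m N} → N ≤ m → series m N ≡ series N N
  series-stable {m} {zero}  _   = refl
  series-stable {m} {suc n} 1+n≤m = cong (λ r → ∑[ i < r ] (c (suc i) * partitionSum next c n (next i) (n ∸ i)))
                                         (trans (ℕ.m≥n⇒m⊓n≡n 1+n≤m) (sym (ℕ.m≥n⇒m⊓n≡n (ℕ.≤-refl {suc n}))))

-- Π⁺ c m and Π⁻ c m are the coefficients of ∏_{k ≤ m} (1 + c k · xᵏ) and ∏_{k ≤ m} (1 − c k · xᵏ)⁻¹.
Π⁺ Π⁻ : (ℕ → ℤ) → ℕ → Series
Π⁺ = series id
Π⁻ = series suc

Π⁺∞ Π⁻∞ : (ℕ → ℤ) → Series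
Π⁺∞ c N = Π⁺ c N N
Π⁻∞ c N = Π⁻ c N N

module _ {c c′ : ℕ → ℤ} (c′≡-c : ∀ k → c′ k ≡ - c k) where

  private
    Π⁻-pred : ∀ m → Π⁻ c′ m ≗ addShifted (c (suc m)) (suc m) (Π⁻ c′ (suc m))
    Π⁻-pred m N = begin
      y                                 ≡⟨ rearrange y a z ⟩
      (y + (- a) * z) + a * z           ≡⟨ cong (λ b → (y + b * z) + a * z) (sym (c′≡-c (suc m))) ⟩
      (y + c′ (suc m) * z) + a * z      ≡⟨ cong (λ t → t + a * z) (sym (series-suc suc c′ m N)) ⟩
      Π⁻ c′ (suc m) N + a * z           ∎
      where
      a = c (suc m)
      y = Π⁻ c′ m N
      z = shift (suc m) (Π⁻ c′ (suc m)) N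
      rearrange : ∀ y a z → y ≡ (y + (- a) * z) + a * z
      rearrange = solve-∀

  Π⁺⊛Π⁻ : ∀ m → Π⁺ c m ⊛ Π⁻ c′ m ≗ 𝟏
  Π⁺⊛Π⁻ zero    N = trans (⊛-cong (series-zero id c) (series-zero suc c′) N) (⊛-identityˡ 𝟏 N)
  Π⁺⊛Π⁻ (suc m) N = begin
    (Π⁺ c (suc m) ⊛ Π⁻ c′ (suc m)) N        ≡⟨ ⊛-cong (series-suc id c m) (λ _ → refl) N ⟩
    (factor (Π⁺ c m) ⊛ Π⁻ c′ (suc m)) N     ≡⟨ addShifted-⊛-transfer (c (suc m)) (suc m) (Π⁺ c m) (Π⁻ c′ (suc m)) N ⟩
    (Π⁺ c m ⊛ factor (Π⁻ c′ (suc m))) N     ≡⟨ ⊛-cong (λ _ → refl) (sym ∘ Π⁻-pred m) N ⟩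
    (Π⁺ c m ⊛ Π⁻ c′ m) N                    ≡⟨ Π⁺⊛Π⁻ m N ⟩
    𝟏 N                                     ∎
    where
    factor : Series → Series
    factor = addShifted (c (suc m)) (suc m)

  Π⁻⊛Π⁺ : ∀ m → Π⁻ c′ m ⊛ Π⁺ c m ≗ 𝟏
  Π⁻⊛Π⁺ zero    N = trans (⊛-cong (series-zero suc c′) (series-zero id c) N) (⊛-identityˡ 𝟏 N)
  Π⁻⊛Π⁺ (suc m) N = begin
    (Π⁻ c′ (suc m) ⊛ Π⁺ c (suc m)) N        ≡⟨ ⊛-cong (λ _ → refl) (series-suc id c m) N ⟩
    (Π⁻ c′ (suc m) ⊛ factor (Π⁺ c m)) N     ≡⟨ sym (addShifted-⊛-transfer (c (suc m)) (suc m) (Π⁻ c′ (suc m)) (Π⁺ c m) N) ⟩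
    (factor (Π⁻ c′ (suc m)) ⊛ Π⁺ c m) N     ≡⟨ ⊛-cong (sym ∘ Π⁻-pred m) (λ _ → refl) N ⟩
    (Π⁻ c′ m ⊛ Π⁺ c m) N                    ≡⟨ Π⁻⊛Π⁺ m N ⟩
    𝟏 N                                     ∎
    where
    factor : Series → Series
    factor = addShifted (c (suc m)) (suc m)

  Π⁺∞⊛Π⁻∞ : Π⁺∞ c ⊛ Π⁻∞ c′ ≗ 𝟏
  Π⁺∞⊛Π⁻∞ N = trans (⊛-local N (λ j j≤N → sym (series-stable id c j≤N)) (λ j j≤N → sym (series-stable suc c′ j≤N)))
                    (Π⁺⊛Π⁻ N N)

  Π⁻∞⊛Π⁺∞ : Π⁻∞ c′ ⊛ Π⁺∞ c ≗ 𝟏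
  Π⁻∞⊛Π⁺∞ N = trans (⊛-local N (λ j j≤N → sym (series-stable suc c′ j≤N)) (λ j j≤N → sym (series-stable id c j≤N)))
                    (Π⁻⊛Π⁺ N N)

sumOver : {A : Set} → (A → ℤ) → List A → ℤ
sumOver w []       = 0ℤ
sumOver w (x ∷ xs) = w x + sumOver w xs

module _ {A : Set} where

  sumOver-cong : ∀ {w w′ : A → ℤ} xs → w ≗ w′ → sumOver w xs ≡ sumOver w′ xs
  sumOver-cong []       eq = refl
  sumOver-cong (x ∷ xs) eq = cong₂ _+_ (eq x) (sumOver-cong xs eq)

  sumOver-++ : ∀ (w : A → ℤ) xs ys → sumOver w (xs ++ ys) ≡ sumOver w xs + sumOver w ys
  sumOver-++ w []       ys = sym (+-identityˡ _)
  sumOver-++ w (x ∷ xs) ys = trans (cong (_+_ (w x)) (sumOver-++ w xs ys)) (+-assoc (w x) _ _)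
    where
    +-assoc : ∀ a b c → a + (b + c) ≡ (a + b) + c
    +-assoc = solve-∀

  sumOver-*ˡ : ∀ a (w : A → ℤ) xs → sumOver (λ x → a * w x) xs ≡ a * sumOver w xs
  sumOver-*ˡ a w []       = sym (*-zeroʳ a)
  sumOver-*ˡ a w (x ∷ xs) = trans (cong (_+_ (a * w x)) (sumOver-*ˡ a w xs)) (distribˡ a (w x) _)
    where
    distribˡ : ∀ a b c → a * b + a * c ≡ a * (b + c)
    distribˡ = solve-∀

  sumOver-minus : ∀ (w w′ : A → ℤ) xs → sumOver (λ x → w x - w′ x) xs ≡ sumOver w xs - sumOver w′ xs
  sumOver-minus w w′ []       = refl
  sumOver-minus w w′ (x ∷ xs) = trans (cong (_+_ (w x - w′ x)) (sumOver-minus w w′ xs)) (interchange (w x) (w′ x) _ _)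
    where
    interchange : ∀ a b c d → (a - b) + (c - d) ≡ (a + c) - (b + d)
    interchange = solve-∀

  sumOver-applyUpTo : ∀ (w : A → ℤ) g n → sumOver w (applyUpTo g n) ≡ ∑< n (w ∘ g)
  sumOver-applyUpTo w g zero    = refl
  sumOver-applyUpTo w g (suc n) = cong (_+_ (w (g 0))) (sumOver-applyUpTo w (g ∘ suc) n)

  length-filterᵇ : ∀ (P : A → Bool) xs → + length (filterᵇ P xs) ≡ sumOver (⟦_⟧ ∘ P) xs
  length-filterᵇ P []       = refl
  length-filterᵇ P (x ∷ xs) with P x
  ... | true  = cong (_+_ 1ℤ) (length-filterᵇ P xs)
  ... | false = trans (length-filterᵇ P xs) (sym (+-identityˡ _))

module _ {A B : Set} (w : B → ℤ) where

  sumOver-map : ∀ (g : A → B) xs → sumOver w (map g xs) ≡ sumOver (w ∘ g) xs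
  sumOver-map g []       = refl
  sumOver-map g (x ∷ xs) = cong (_+_ (w (g x))) (sumOver-map g xs)

  sumOver-concatMap : ∀ (F : A → List B) xs → sumOver w (concatMap F xs) ≡ sumOver (sumOver w ∘ F) xs
  sumOver-concatMap F []       = refl
  sumOver-concatMap F (x ∷ xs) =
    trans (sumOver-++ w (F x) (concatMap F xs)) (cong (_+_ (sumOver w (F x))) (sumOver-concatMap F xs))

sumOver-partitionsLE-suc : ∀ (w : List ℕ → ℤ) f m n →
  sumOver w (partitionsLE (suc f) m (suc n)) ≡
  ∑[ i < m ⊓ suc n ] sumOver (w ∘ (suc i ∷_)) (partitionsLE f (suc i) (n ∸ i))
sumOver-partitionsLE-suc w f m n = begin
  sumOver w (concatMap firstPart (applyUpTo suc (m ⊓ suc n)))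
    ≡⟨ sumOver-concatMap w firstPart (applyUpTo suc (m ⊓ suc n)) ⟩
  sumOver (sumOver w ∘ firstPart) (applyUpTo suc (m ⊓ suc n))
    ≡⟨ sumOver-applyUpTo (sumOver w ∘ firstPart) suc (m ⊓ suc n) ⟩
  ∑[ i < m ⊓ suc n ] sumOver w (map (suc i ∷_) (partitionsLE f (suc i) (n ∸ i)))
    ≡⟨ ∑-cong (m ⊓ suc n) (λ i → sumOver-map w (suc i ∷_) (partitionsLE f (suc i) (n ∸ i))) ⟩
  ∑[ i < m ⊓ suc n ] sumOver (w ∘ (suc i ∷_)) (partitionsLE f (suc i) (n ∸ i)) ∎
  where
  firstPart : ℕ → List (List ℕ)
  firstPart k = map (k ∷_) (partitionsLE f k (suc n ∸ k))

module _ (c : ℕ → ℤ) where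

  weight : List ℕ → ℤ
  weight []       = 1ℤ
  weight (x ∷ xs) = c x * weight xs

  distinctWeightBelow : ℕ → List ℕ → ℤ
  distinctWeightBelow b []       = 1ℤ
  distinctWeightBelow b (x ∷ xs) = ⟦ x <ᵇ b ⟧ * (c x * distinctWeightBelow x xs)

  distinctWeight : List ℕ → ℤ
  distinctWeight []       = 1ℤ
  distinctWeight (x ∷ xs) = c x * distinctWeightBelow x xs

  sumOver-weight : ∀ f m N → sumOver weight (partitionsLE f m N) ≡ partitionSum suc c f m N
  sumOver-weight f       m zero    = refl
  sumOver-weight zero    m (suc n) = refl
  sumOver-weight (suc f) m (suc n) =
    trans (sumOver-partitionsLE-suc weight f m n) (∑-cong (m ⊓ suc n) λ i →
      trans (sumOver-*ˡ (c (suc i)) weight (partitionsLE f (suc i) (n ∸ i)))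
            (cong (c (suc i) *_) (sumOver-weight f (suc i) (n ∸ i))))

  sumOver-distinctWeightBelow : ∀ f m b N →
    sumOver (distinctWeightBelow (suc b)) (partitionsLE f m N) ≡ partitionSum id c f (m ⊓ b) N
  sumOver-distinctWeightBelow-diagonal : ∀ f i N →
    sumOver (distinctWeightBelow (suc i)) (partitionsLE f (suc i) N) ≡ partitionSum id c f i N

  sumOver-distinctWeightBelow f       m b zero    = refl
  sumOver-distinctWeightBelow zero    m b (suc n) = refl
  sumOver-distinctWeightBelow (suc f) m b (suc n) = begin
    sumOver (distinctWeightBelow (suc b)) (partitionsLE (suc f) m (suc n))
      ≡⟨ sumOver-partitionsLE-suc (distinctWeightBelow (suc b)) f m n ⟩
    ∑[ i < m ⊓ suc n ] sumOver (λ μ → ⟦ i <ᵇ b ⟧ * (c (suc i) * distinctWeightBelow (suc i) μ)) (tails i)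
      ≡⟨ ∑-cong (m ⊓ suc n) headTerm ⟩
    ∑[ i < m ⊓ suc n ] (⟦ i <ᵇ b ⟧ * term i)
      ≡⟨ ∑-⊓ (m ⊓ suc n) b term ⟩
    ∑< (m ⊓ suc n ⊓ b) term
      ≡⟨ cong (λ r → ∑< r term) (xy∙z≈xz∙y m (suc n) b) ⟩
    ∑< (m ⊓ b ⊓ suc n) term ∎
    where
    tails : ℕ → List (List ℕ)
    tails i = partitionsLE f (suc i) (n ∸ i)
    term : ℕ → ℤ
    term i = c (suc i) * partitionSum id c f i (n ∸ i)
    headTerm : ∀ i → sumOver (λ μ → ⟦ i <ᵇ b ⟧ * (c (suc i) * distinctWeightBelow (suc i) μ)) (tails i)
                   ≡ ⟦ i <ᵇ b ⟧ * term i
    headTerm i =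
      trans (sumOver-*ˡ ⟦ i <ᵇ b ⟧ (λ μ → c (suc i) * distinctWeightBelow (suc i) μ) (tails i))
            (cong (⟦ i <ᵇ b ⟧ *_) (trans (sumOver-*ˡ (c (suc i)) (distinctWeightBelow (suc i)) (tails i))
                                         (cong (c (suc i) *_) (sumOver-distinctWeightBelow-diagonal f i (n ∸ i)))))

  sumOver-distinctWeightBelow-diagonal f i N =
    trans (sumOver-distinctWeightBelow f (suc i) i N)
          (cong (λ r → partitionSum id c f r N) (ℕ.m≥n⇒m⊓n≡n (ℕ.n≤1+n i)))

  sumOver-distinctWeight : ∀ f m N → sumOver distinctWeight (partitionsLE f m N) ≡ partitionSum id c f m N
  sumOver-distinctWeight f       m zero    = refl
  sumOver-distinctWeight zero    m (suc n) = refl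
  sumOver-distinctWeight (suc f) m (suc n) =
    trans (sumOver-partitionsLE-suc distinctWeight f m n) (∑-cong (m ⊓ suc n) λ i →
      trans (sumOver-*ˡ (c (suc i)) (distinctWeightBelow (suc i)) (partitionsLE f (suc i) (n ∸ i)))
            (cong (c (suc i) *_) (sumOver-distinctWeightBelow-diagonal f i (n ∸ i))))

weightOn : (ℕ → Bool) → ℤ → ℕ → ℤ
weightOn S s k = if S k then s else 0ℤ

weightOn-neg : ∀ S k → weightOn S -1ℤ k ≡ - weightOn S 1ℤ k
weightOn-neg S k with S k
... | true  = refl
... | false = refl

weight-weightOn : ∀ S s xs → weight (weightOn S s) xs ≡ (if partsIn S xs then s ^ length xs else 0ℤ)
weight-weightOn S s []       = refl
weight-weightOn S s (x ∷ xs) with S x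
... | false = refl
... | true rewrite weight-weightOn S s xs with partsIn S xs
...   | true  = refl
...   | false = *-zeroʳ s

⟦⟧-interchange : ∀ a b c d → ⟦ a ⟧ * (⟦ b ⟧ * ⟦ c ∧ d ⟧) ≡ ⟦ (a ∧ c) ∧ (b ∧ d) ⟧
⟦⟧-interchange false _     _     _     = refl
⟦⟧-interchange true  false false _     = refl
⟦⟧-interchange true  false true  _     = refl
⟦⟧-interchange true  true  false _     = refl
⟦⟧-interchange true  true  true  false = refl
⟦⟧-interchange true  true  true  true  = refl

distinctWeightBelow-weightOn : ∀ S b xs →
  distinctWeightBelow (weightOn S 1ℤ) b xs ≡ ⟦ strictlyDecreasing (b ∷ xs) ∧ partsIn S xs ⟧
distinctWeightBelow-weightOn S b []       = refl
distinctWeightBelow-weightOn S b (x ∷ xs) =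
  trans (cong (λ t → ⟦ x <ᵇ b ⟧ * (⟦ S x ⟧ * t)) (distinctWeightBelow-weightOn S x xs))
        (⟦⟧-interchange (x <ᵇ b) (S x) (strictlyDecreasing (x ∷ xs)) (partsIn S xs))

distinctWeight-weightOn : ∀ S xs → distinctWeight (weightOn S 1ℤ) xs ≡ ⟦ partsIn S xs ∧ strictlyDecreasing xs ⟧
distinctWeight-weightOn S []       = refl
distinctWeight-weightOn S (x ∷ xs) rewrite distinctWeightBelow-weightOn S x xs with S x
... | true  = trans (*-identityˡ _) (cong ⟦_⟧ (∧-comm (strictlyDecreasing (x ∷ xs)) (partsIn S xs)))
... | false = refl

-1^≡parity : ∀ n → -1ℤ ^ n ≡ (if isEven n then 1ℤ else -1ℤ)
-1^≡parity zero          = refl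
-1^≡parity (suc zero)    = refl
-1^≡parity (suc (suc n)) = trans (square (-1ℤ ^ n)) (-1^≡parity n)
  where
  square : ∀ x → -1ℤ * (-1ℤ * x) ≡ x
  square = solve-∀

-1^odd : ∀ {n} → n % 2 ≡ 1 → -1ℤ ^ n ≡ -1ℤ
-1^odd {n} odd = trans (-1^≡parity n) (cong (λ r → if r ≡ᵇ 0 then 1ℤ else -1ℤ) odd)

q≡Π⁺∞ : ∀ S N → + q S N ≡ Π⁺∞ (weightOn S 1ℤ) N
q≡Π⁺∞ S N = begin
  + q S N
    ≡⟨ length-filterᵇ (λ xs → partsIn S xs ∧ strictlyDecreasing xs) (partitions N) ⟩
  sumOver (λ xs → ⟦ partsIn S xs ∧ strictlyDecreasing xs ⟧) (partitions N)
    ≡⟨ sumOver-cong (partitions N) (sym ∘ distinctWeight-weightOn S) ⟩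
  sumOver (distinctWeight (weightOn S 1ℤ)) (partitions N)
    ≡⟨ sumOver-distinctWeight (weightOn S 1ℤ) N N N ⟩
  Π⁺∞ (weightOn S 1ℤ) N ∎

p≡Π⁻∞ : ∀ S N → + p S N ≡ Π⁻∞ (weightOn S 1ℤ) N
p≡Π⁻∞ S N = begin
  + p S N                                         ≡⟨ length-filterᵇ (partsIn S) (partitions N) ⟩
  sumOver (⟦_⟧ ∘ partsIn S) (partitions N)         ≡⟨ sumOver-cong (partitions N) (sym ∘ weight-indicator) ⟩
  sumOver (weight (weightOn S 1ℤ)) (partitions N)  ≡⟨ sumOver-weight (weightOn S 1ℤ) N N N ⟩
  Π⁻∞ (weightOn S 1ℤ) N                           ∎
  where
  weight-indicator : ∀ xs → weight (weightOn S 1ℤ) xs ≡ ⟦ partsIn S xs ⟧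
  weight-indicator xs rewrite weight-weightOn S 1ℤ xs with partsIn S xs
  ... | true  = ^-zeroˡ (length xs)
  ... | false = refl

pₑ-pₒ≡Π⁻∞ : ∀ S N → + pₑ S N - + pₒ S N ≡ Π⁻∞ (weightOn S -1ℤ) N
pₑ-pₒ≡Π⁻∞ S N = begin
  + pₑ S N - + pₒ S N
    ≡⟨ cong₂ _-_ (length-filterᵇ even (partitions N)) (length-filterᵇ odd (partitions N)) ⟩
  sumOver (⟦_⟧ ∘ even) (partitions N) - sumOver (⟦_⟧ ∘ odd) (partitions N)
    ≡⟨ sym (sumOver-minus (⟦_⟧ ∘ even) (⟦_⟧ ∘ odd) (partitions N)) ⟩
  sumOver (λ xs → ⟦ even xs ⟧ - ⟦ odd xs ⟧) (partitions N)
    ≡⟨ sumOver-cong (partitions N) (sym ∘ weight-sign) ⟩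
  sumOver (weight (weightOn S -1ℤ)) (partitions N)
    ≡⟨ sumOver-weight (weightOn S -1ℤ) N N N ⟩
  Π⁻∞ (weightOn S -1ℤ) N ∎
  where
  even odd : List ℕ → Bool
  even xs = partsIn S xs ∧ isEven (length xs)
  odd  xs = partsIn S xs ∧ not (isEven (length xs))
  weight-sign : ∀ xs → weight (weightOn S -1ℤ) xs ≡ ⟦ even xs ⟧ - ⟦ odd xs ⟧
  weight-sign xs rewrite weight-weightOn S -1ℤ xs | -1^≡parity (length xs)
    with partsIn S xs | isEven (length xs)
  ... | true  | true  = refl
  ... | true  | false = refl
  ... | false | _     = refl

-- Replacing c k by (−1)ᵏ c k substitutes −x for x.
signTwist : (ℕ → ℤ) → ℕ → ℤ
signTwist c k = -1ℤ ^ k * c k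

partitionSum-signTwist : ∀ next c f m N →
  partitionSum next (signTwist c) f m N ≡ -1ℤ ^ N * partitionSum next c f m N
partitionSum-signTwist next c f       m zero    = refl
partitionSum-signTwist next c zero    m (suc n) = sym (*-zeroʳ (-1ℤ ^ suc n))
partitionSum-signTwist next c (suc f) m (suc n) =
  trans (∑-cong< (m ⊓ suc n) twistedTerm)
        (∑-*ˡ (m ⊓ suc n) (-1ℤ ^ suc n) (λ i → c (suc i) * partitionSum next c f (next i) (n ∸ i)))
  where
  interchange : ∀ a b x y → (a * x) * (b * y) ≡ (a * b) * (x * y)
  interchange = solve-∀
  twistedTerm : ∀ i → i < m ⊓ suc n →
    signTwist c (suc i) * partitionSum next (signTwist c) f (next i) (n ∸ i)
      ≡ -1ℤ ^ suc n * (c (suc i) * partitionSum next c f (next i) (n ∸ i))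
  twistedTerm i i<m⊓1+n = begin
    signTwist c (suc i) * partitionSum next (signTwist c) f (next i) (n ∸ i)
      ≡⟨ cong (signTwist c (suc i) *_) (partitionSum-signTwist next c f (next i) (n ∸ i)) ⟩
    (-1ℤ ^ suc i * c (suc i)) * (-1ℤ ^ (n ∸ i) * partitionSum next c f (next i) (n ∸ i))
      ≡⟨ interchange (-1ℤ ^ suc i) (-1ℤ ^ (n ∸ i)) _ _ ⟩
    (-1ℤ ^ suc i * -1ℤ ^ (n ∸ i)) * (c (suc i) * partitionSum next c f (next i) (n ∸ i))
      ≡⟨ cong (λ e → e * (c (suc i) * partitionSum next c f (next i) (n ∸ i)))
              (trans (sym (^-distribˡ-+-* -1ℤ (suc i) (n ∸ i))) (cong (λ e → -1ℤ ^ suc e) (ℕ.m+[n∸m]≡n i≤n))) ⟩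
    -1ℤ ^ suc n * (c (suc i) * partitionSum next c f (next i) (n ∸ i)) ∎
    where
    i≤n : i ≤ n
    i≤n = s≤s⁻¹ (ℕ.≤-trans i<m⊓1+n (ℕ.m⊓n≤n m (suc n)))

Π⁺∞-signTwist : ∀ c N → Π⁺∞ (signTwist c) N ≡ -1ℤ ^ N * Π⁺∞ c N
Π⁺∞-signTwist c N = partitionSum-signTwist id c N N N

weightOn-odd : ∀ S → (∀ k → S k ≡ true → k % 2 ≡ 1) → ∀ k → weightOn S 1ℤ k ≡ - signTwist (weightOn S 1ℤ) k
weightOn-odd S odd k with S k in Sk
... | true  = sym (cong (λ z → - (z * 1ℤ)) (-1^odd {k} (odd k Sk)))
... | false = sym (cong -_ (*-zeroʳ (-1ℤ ^ k)))

corollary3p3 : (S₁ S₂ : ℕ → Bool) → EulerPair S₁ S₂ →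
    (∀ (k : ℕ) → S₂ k ≡ true → k % 2 ≡ 1) →
    ∀ (n : ℕ) → (-1ℤ ^ n) * (+ q S₂ n) ≡ (+ pₑ S₁ n) - (+ pₒ S₁ n)
corollary3p3 S₁ S₂ euler odd n = begin
  -1ℤ ^ n * + q S₂ n                    ≡⟨ cong (-1ℤ ^ n *_) (q≡Π⁺∞ S₂ n) ⟩
  -1ℤ ^ n * Π⁺∞ (weightOn S₂ 1ℤ) n      ≡⟨ sym (Π⁺∞-signTwist (weightOn S₂ 1ℤ) n) ⟩
  Π⁺∞ (signTwist (weightOn S₂ 1ℤ)) n    ≡⟨ ⊛-cancelˡ {u = qS₁} refl (λ N → trans (inverse₂ N) (sym (inverse₁ N))) n ⟩
  Π⁻∞ (weightOn S₁ -1ℤ) n               ≡⟨ sym (pₑ-pₒ≡Π⁻∞ S₁ n) ⟩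
  + pₑ S₁ n - + pₒ S₁ n                 ∎
  where
  qS₁ : Series
  qS₁ N = + q S₁ N
  inverse₁ : qS₁ ⊛ Π⁻∞ (weightOn S₁ -1ℤ) ≗ 𝟏
  inverse₁ N = trans (⊛-cong (q≡Π⁺∞ S₁) (λ _ → refl) N) (Π⁺∞⊛Π⁻∞ (weightOn-neg S₁) N)
  inverse₂ : qS₁ ⊛ Π⁺∞ (signTwist (weightOn S₂ 1ℤ)) ≗ 𝟏
  inverse₂ N = trans (⊛-cong (λ j → trans (cong +_ (euler j)) (p≡Π⁻∞ S₂ j)) (λ _ → refl) N)
                     (Π⁻∞⊛Π⁺∞ (weightOn-odd S₂ odd) N)
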